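{- Let $r\geqslant 3$ be an odd integer and let $\Gamma\cong\mathbb{Z}_{2r}\oplus\mathbb{Z}_2\oplus\mathbb{Z}_2\oplus\mathbb{Z}_2$. Then there exists a zero-sum $\Gamma$-magic rectangle set $\mathrm{MRS}_\Gamma(r,8;2)$, i.e. two $r\times 8$ arrays with entries in $\Gamma$ such that every element of $\Gamma$ appears exactly once and in exactly one of the two arrays, and every row sum and every column sum of each array equals $0_\Gamma$. -}

module Defs where

open import Data.Nat using (ℕ; zero; suc; _+_; _*_)
open import Data.Nat.DivMod using (_mod_)
open import Data.Fin using (Fin; toℕ) renaming (zero to fzero; suc to fsuc)
open import Data.Product using (_×_; _,_)
open import Function.Definitions using (Bijective)
open import Relation.Binary.PropositionalEquality using (_≡_)

_+ℤ_ : {n : ℕ} → Fin n → Fin n → Fin n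
_+ℤ_ {suc n} a b = (toℕ a + toℕ b) mod (suc n)

Γ : ℕ → Set
Γ r = Fin (2 * r) × Fin 2 × Fin 2 × Fin 2

_⊕_ : {r : ℕ} → Γ r → Γ r → Γ r
(a , b , c , d) ⊕ (a' , b' , c' , d') = (a +ℤ a') , (b +ℤ b') , (c +ℤ c') , (d +ℤ d')

-- identity element 0_Γ (only meaningful when 2r > 0; we take r = suc k)
0Γ : (k : ℕ) → Γ (suc k)
0Γ k = fzero , fzero , fzero , fzero

ΣΓ : {k : ℕ} (n : ℕ) → (Fin n → Γ (suc k)) → Γ (suc k)
ΣΓ {k} zero f = 0Γ k
ΣΓ {k} (suc n) f = _⊕_ {suc k} (f fzero) (ΣΓ n (λ i → f (fsuc i)))

-- Zero-sum Γ-magic rectangle set MRS_Γ(a, b; c) for Γ = Γ(suc k):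
-- c arrays of size a × b, A t i j is entry (i,j) of array t;
-- every element of Γ appears exactly once overall (bijectivity of the entry map),
-- every row sum and column sum of every array is 0_Γ.
record ZeroSumMRS (k a b c : ℕ) : Set where
  field
    A         : Fin c → Fin a → Fin b → Γ (suc k)
    bijective : Bijective _≡_ _≡_ (λ (p : Fin c × Fin a × Fin b) →
                  let (t , i , j) = p in A t i j)
    rowSum    : ∀ t i → ΣΓ b (λ j → A t i j) ≡ 0Γ k
    colSum    : ∀ t j → ΣΓ a (λ i → A t i j) ≡ 0Γ k

-- Write r = 2n + 1 and a ∈ ℤ_{2r} as a = h·r + z with h ∈ ℤ₂ and z ∈ ℤ_r, and split ℤ_r into 0
-- and the n pairs {m + 1, r − (m + 1)}.  Row 0 of the two arrays holds the 16 elements with z = 0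
-- and, for every m, two rows hold the 32 elements with z ∈ {m + 1, r − (m + 1)}.  Within a row the
-- cells are matched with labels in ℤ₂ × ℤ₂³ by one of three fixed tables, and a sign bit chooses
-- between m + 1 and r − (m + 1), oppositely in the two rows of a pair.  Each row then has four
-- entries of each sign and an even number of h = 1, so its ℤ_{2r}-sum is a multiple of 2r; in each
-- column the two rows of a pair m ≥ 1 add up to exactly 2r, while row 0 and the two rows of pair 0
-- cancel by the choice of the tables.  The finitely many
-- facts about the tables are decided by computation; all other sums are computed in ℕ via toℕ.
module Submission where

open import Defs
open import Data.Nat using (ℕ; suc; _≤_; _%_)
open import Relation.Binary.PropositionalEquality using (_≡_)

open import Data.Nat as ℕ using (zero; _+_; _*_; NonZero; s≤s)
open import Data.Nat.Properties
  using (+-0-commutativeMonoid; +-*-semiring; +-assoc; +-comm; +-suc; +-identityʳ;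
         *-comm; *-distribˡ-+; m+[n∸m]≡n)
open import Data.Nat.DivMod using (_mod_; %-distribˡ-+; m%n%n≡m%n)
open import Data.Nat.Divisibility
  using (_∣_; divides; _∣0; _∣?_; ∣m∣n⇒∣m+n; *-monoʳ-∣; n∣m⇒m%n≡0; module ∣-Reasoning)
open import Data.Nat.Tactic.RingSolver using (solve-∀)
open import Algebra.Properties.CommutativeMonoid.Sum +-0-commutativeMonoid
  using (sum; sum-syntax; sum-cong-≗; ∑-distrib-+)
open import Algebra.Properties.Semiring.Sum +-*-semiring using (*-distribˡ-sum; *-distribʳ-sum)
open import Data.Fin using (Fin; toℕ; splitAt; join; _↑ˡ_; _↑ʳ_; opposite; combine; remQuot)
  renaming (zero to fzero; suc to fsuc)
open import Data.Fin.Patterns using (0F; 1F; 2F; 3F; 4F; 5F; 6F; 7F)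
open import Data.Fin.Properties
  using (_≟_; all?; any?; toℕ-injective; toℕ-fromℕ<; toℕ<n; toℕ-↑ˡ; toℕ-↑ʳ; splitAt-↑ˡ;
         splitAt-↑ʳ; join-splitAt; opposite-prop; opposite-involutive; toℕ-combine;
         remQuot-combine; combine-remQuot)
open import Data.Product using (_×_; _,_; proj₁; proj₂; ∃)
open import Data.Product.Properties using (≡-dec)
open import Data.Sum using ([_,_]′; inj₁; inj₂)
open import Data.Vec.Functional using (foldr)
open import Function using (_∘_; _↔_; mk↔ₛ′; Inverse; Bijection)
open import Function.Properties.Inverse using (↔-trans; Inverse⇒Bijection)
open import Relation.Binary.Definitions using (DecidableEquality)
open import Relation.Binary.PropositionalEquality
  using (refl; sym; trans; cong; cong₂; subst; module ≡-Reasoning)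
open import Relation.Nullary.Decidable
  using (Dec; yes; no; map′; _×-dec_; True; toWitness; from-yes)
open import Relation.Nullary.Negation using (contradiction)

+ℤ₂-cancelʳ : ∀ (a b : Fin 2) → (a +ℤ b) +ℤ b ≡ a
+ℤ₂-cancelʳ 0F 0F = refl
+ℤ₂-cancelʳ 0F 1F = refl
+ℤ₂-cancelʳ 1F 0F = refl
+ℤ₂-cancelʳ 1F 1F = refl

+ℤ₂-cancelˡ : ∀ (a b : Fin 2) → a +ℤ (a +ℤ b) ≡ b
+ℤ₂-cancelˡ 0F 0F = refl
+ℤ₂-cancelˡ 0F 1F = refl
+ℤ₂-cancelˡ 1F 0F = refl
+ℤ₂-cancelˡ 1F 1F = refl

[m+n%d]%d≡[m+n]%d : ∀ m n {d} .{{_ : NonZero d}} → (m + n % d) % d ≡ (m + n) % d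
[m+n%d]%d≡[m+n]%d m n {d} = begin
  (m + n % d) % d           ≡⟨ %-distribˡ-+ m (n % d) d ⟩
  (m % d + n % d % d) % d   ≡⟨ cong (λ x → (m % d + x) % d) (m%n%n≡m%n n d) ⟩
  (m % d + n % d) % d       ≡⟨ %-distribˡ-+ m n d ⟨
  (m + n) % d               ∎
  where open ≡-Reasoning

2∣n+n : ∀ a → 2 ∣ a + a
2∣n+n a = divides a (double a)
  where
  double : ∀ a → a + a ≡ a * 2
  double = solve-∀

∑-∣ : ∀ {d k} (f : Fin k → ℕ) → (∀ i → d ∣ f i) → d ∣ ∑[ i < k ] f i
∑-∣ {d} {zero}  f p = d ∣0
∑-∣ {d} {suc k} f p = ∣m∣n⇒∣m+n (p 0F) (∑-∣ (f ∘ fsuc) (p ∘ fsuc))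

∑-↑ : ∀ m {n} (f : Fin (m + n) → ℕ) →
      ∑[ i < m + n ] f i ≡ ∑[ i < m ] f (i ↑ˡ n) + ∑[ i < n ] f (m ↑ʳ i)
∑-↑ zero    f = refl
∑-↑ (suc m) f = trans (cong (f 0F +_) (∑-↑ m (f ∘ fsuc))) (sym (+-assoc (f 0F) _ _))

∑-two-valued : ∀ {k} (σ : Fin k → Fin 2) (g : Fin 2 → ℕ) →
  ∑[ j < k ] g (σ j) ≡ ∑[ j < k ] toℕ (σ j +ℤ 1F) * g 0F + ∑[ j < k ] toℕ (σ j) * g 1F
∑-two-valued {k} σ g = begin
  ∑[ j < k ] g (σ j)
    ≡⟨ sum-cong-≗ (split ∘ σ) ⟩
  ∑[ j < k ] (toℕ (σ j +ℤ 1F) * g 0F + toℕ (σ j) * g 1F)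
    ≡⟨ ∑-distrib-+ (λ j → toℕ (σ j +ℤ 1F) * g 0F) (λ j → toℕ (σ j) * g 1F) ⟩
  ∑[ j < k ] (toℕ (σ j +ℤ 1F) * g 0F) + ∑[ j < k ] (toℕ (σ j) * g 1F)
    ≡⟨ cong₂ _+_ (*-distribʳ-sum (g 0F) (λ j → toℕ (σ j +ℤ 1F)))
                 (*-distribʳ-sum (g 1F) (λ j → toℕ (σ j))) ⟨
  ∑[ j < k ] toℕ (σ j +ℤ 1F) * g 0F + ∑[ j < k ] toℕ (σ j) * g 1F ∎
  where
  open ≡-Reasoning
  split : ∀ s → g s ≡ toℕ (s +ℤ 1F) * g 0F + toℕ s * g 1F
  split 0F = sym (trans (+-identityʳ _) (+-identityʳ (g 0F)))
  split 1F = sym (+-identityʳ (g 1F))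

∑ℤ : ∀ {M k} → (Fin k → Fin (suc M)) → Fin (suc M)
∑ℤ = foldr _+ℤ_ 0F

toℕ-∑ℤ : ∀ {M k} (f : Fin k → Fin (suc M)) → toℕ (∑ℤ f) ≡ (∑[ i < k ] toℕ (f i)) % suc M
toℕ-∑ℤ {k = zero} f = refl
toℕ-∑ℤ {M} {suc k} f = begin
  toℕ ((toℕ (f 0F) + toℕ (∑ℤ (f ∘ fsuc))) mod suc M)
    ≡⟨ toℕ-fromℕ< _ ⟩
  (toℕ (f 0F) + toℕ (∑ℤ (f ∘ fsuc))) % suc M
    ≡⟨ cong (λ s → (toℕ (f 0F) + s) % suc M) (toℕ-∑ℤ (f ∘ fsuc)) ⟩
  (toℕ (f 0F) + sum (toℕ ∘ f ∘ fsuc) % suc M) % suc M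
    ≡⟨ [m+n%d]%d≡[m+n]%d (toℕ (f 0F)) (sum (toℕ ∘ f ∘ fsuc)) ⟩
  (toℕ (f 0F) + sum (toℕ ∘ f ∘ fsuc)) % suc M ∎
  where open ≡-Reasoning

∣⇒∑ℤ≡0 : ∀ {M k} (f : Fin k → Fin (suc M)) → suc M ∣ ∑[ i < k ] toℕ (f i) → ∑ℤ f ≡ 0F
∣⇒∑ℤ≡0 {M} f d = toℕ-injective (trans (toℕ-∑ℤ f) (n∣m⇒m%n≡0 _ (suc M) d))

E : Set
E = Fin 2 × Fin 2 × Fin 2

coordinate : Fin 3 → E → Fin 2
coordinate 0F (a , _ , _) = a
coordinate 1F (_ , b , _) = b
coordinate 2F (_ , _ , c) = c

ΣΓ-coordinates : ∀ {k} m (f : Fin m → Γ (suc k)) →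
  ΣΓ m f ≡ (∑ℤ (proj₁ ∘ f) , ∑ℤ (coordinate 0F ∘ proj₂ ∘ f) ,
            ∑ℤ (coordinate 1F ∘ proj₂ ∘ f) , ∑ℤ (coordinate 2F ∘ proj₂ ∘ f))
ΣΓ-coordinates     zero    f = refl
ΣΓ-coordinates {k} (suc m) f = cong (_⊕_ {suc k} (f 0F)) (ΣΓ-coordinates m (f ∘ fsuc))

ΣΓ≡0Γ : ∀ {k m} (f : Fin m → Γ (suc k)) →
        2 * suc k ∣ ∑[ i < m ] toℕ (proj₁ (f i)) →
        (∀ c → 2 ∣ ∑[ i < m ] toℕ (coordinate c (proj₂ (f i)))) →
        ΣΓ m f ≡ 0Γ k
ΣΓ≡0Γ {m = m} f ℤ-part E-part = trans (ΣΓ-coordinates m f)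
  (cong₂ _,_ (∣⇒∑ℤ≡0 (proj₁ ∘ f) ℤ-part)
    (cong₂ _,_ (coordinate≡0 0F) (cong₂ _,_ (coordinate≡0 1F) (coordinate≡0 2F))))
  where
  coordinate≡0 : ∀ c → ∑ℤ (coordinate c ∘ proj₂ ∘ f) ≡ 0F
  coordinate≡0 c = ∣⇒∑ℤ≡0 (coordinate c ∘ proj₂ ∘ f) (E-part c)

-- A level names both a row of the arrays (via fromLevel) and a residue z ∈ ℤ_r (via residue):
-- base is row 0 and residue 0, while pair m σ is residue m + 1 for σ = 0F and r − (m + 1)
-- for σ = 1F.
data Level (n : ℕ) : Set where
  base : Level n
  pair : Fin n → Fin 2 → Level n

module Levels (n : ℕ) where

  fromLevel : Level n → Fin (suc (n + n))
  fromLevel base        = 0F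
  fromLevel (pair m 0F) = fsuc (m ↑ˡ n)
  fromLevel (pair m 1F) = fsuc (n ↑ʳ m)

  toLevel : Fin (suc (n + n)) → Level n
  toLevel fzero    = base
  toLevel (fsuc i) = [ (λ m → pair m 0F) , (λ m → pair m 1F) ]′ (splitAt n i)

  toLevel-fromLevel : ∀ ℓ → toLevel (fromLevel ℓ) ≡ ℓ
  toLevel-fromLevel base        = refl
  toLevel-fromLevel (pair m 0F) = cong [ _ , _ ]′ (splitAt-↑ˡ n m n)
  toLevel-fromLevel (pair m 1F) = cong [ _ , _ ]′ (splitAt-↑ʳ n n m)

  fromLevel-toLevel : ∀ i → fromLevel (toLevel i) ≡ i
  fromLevel-toLevel fzero = refl
  fromLevel-toLevel (fsuc i) with splitAt n i in eq
  ... | inj₁ m = cong fsuc (trans (cong (join n n) (sym eq)) (join-splitAt n n i))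
  ... | inj₂ m = cong fsuc (trans (cong (join n n) (sym eq)) (join-splitAt n n i))

  ∑-levels : ∀ (g : Level n → ℕ) →
    ∑[ i < suc (n + n) ] g (toLevel i) ≡ g base + ∑[ m < n ] (g (pair m 0F) + g (pair m 1F))
  ∑-levels g = cong (g base +_) (begin
    ∑[ i < n + n ] g (toLevel (fsuc i))
      ≡⟨ ∑-↑ n (g ∘ toLevel ∘ fsuc) ⟩
    ∑[ m < n ] g (toLevel (fsuc (m ↑ˡ n))) + ∑[ m < n ] g (toLevel (fsuc (n ↑ʳ m)))
      ≡⟨ cong₂ _+_ (sum-cong-≗ (cong g ∘ toLevel-fromLevel ∘ (λ m → pair m 0F)))
                   (sum-cong-≗ (cong g ∘ toLevel-fromLevel ∘ (λ m → pair m 1F))) ⟩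
    ∑[ m < n ] g (pair m 0F) + ∑[ m < n ] g (pair m 1F)
      ≡⟨ ∑-distrib-+ (g ∘ (λ m → pair m 0F)) (g ∘ (λ m → pair m 1F)) ⟨
    ∑[ m < n ] (g (pair m 0F) + g (pair m 1F)) ∎)
    where open ≡-Reasoning

  reflect : Level n → Level n
  reflect base        = base
  reflect (pair m 0F) = pair m 0F
  reflect (pair m 1F) = pair (opposite m) 1F

  reflect-involutive : ∀ ℓ → reflect (reflect ℓ) ≡ ℓ
  reflect-involutive base        = refl
  reflect-involutive (pair m 0F) = refl
  reflect-involutive (pair m 1F) = cong (λ m′ → pair m′ 1F) (opposite-involutive m)

  residue : Level n → Fin (suc (n + n))
  residue = fromLevel ∘ reflect

  residueLevel : Fin (suc (n + n)) → Level n
  residueLevel = reflect ∘ toLevel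

  residueLevel-residue : ∀ ℓ → residueLevel (residue ℓ) ≡ ℓ
  residueLevel-residue ℓ =
    trans (cong reflect (toLevel-fromLevel (reflect ℓ))) (reflect-involutive ℓ)

  residue-residueLevel : ∀ z → residue (residueLevel z) ≡ z
  residue-residueLevel z =
    trans (cong fromLevel (reflect-involutive (toLevel z))) (fromLevel-toLevel z)

  residues-complementary : ∀ m σ →
    toℕ (residue (pair m σ)) + toℕ (residue (pair m (σ +ℤ 1F))) ≡ suc (n + n)
  residues-complementary m 0F = begin
    suc (toℕ (m ↑ˡ n)) + suc (toℕ (n ↑ʳ opposite m))
      ≡⟨ cong₂ (λ a b → suc a + suc b) (toℕ-↑ˡ m n) (toℕ-↑ʳ n (opposite m)) ⟩
    suc (toℕ m) + suc (n + toℕ (opposite m))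
      ≡⟨ shuffle (toℕ m) n (toℕ (opposite m)) ⟩
    suc (n + (suc (toℕ m) + toℕ (opposite m)))
      ≡⟨ cong (λ a → suc (n + a)) m+opposite ⟩
    suc (n + n) ∎
    where
    open ≡-Reasoning
    shuffle : ∀ a b c → suc a + suc (b + c) ≡ suc (b + (suc a + c))
    shuffle = solve-∀
    m+opposite : suc (toℕ m) + toℕ (opposite m) ≡ n
    m+opposite = trans (cong (suc (toℕ m) +_) (opposite-prop m)) (m+[n∸m]≡n (toℕ<n m))
  residues-complementary m 1F =
    trans (+-comm (toℕ (residue (pair m 1F))) _) (residues-complementary m 0F)

  r : ℕ
  r = suc (n + n)

  2r∣r*even : ∀ {K} → 2 ∣ K → 2 * r ∣ r * K
  2r∣r*even {K} 2∣K = subst (_∣ r * K) (*-comm r 2) (*-monoʳ-∣ r 2∣K)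

  ∑-combine : ∀ {k} (h : Fin k → Fin 2) (ℓ : Fin k → Level n) →
    ∑[ j < k ] toℕ (combine (h j) (residue (ℓ j))) ≡
    r * ∑[ j < k ] toℕ (h j) + ∑[ j < k ] toℕ (residue (ℓ j))
  ∑-combine {k} h ℓ = begin
    ∑[ j < k ] toℕ (combine (h j) (residue (ℓ j)))
      ≡⟨ sum-cong-≗ (λ j → toℕ-combine (h j) (residue (ℓ j))) ⟩
    ∑[ j < k ] (r * toℕ (h j) + toℕ (residue (ℓ j)))
      ≡⟨ ∑-distrib-+ (λ j → r * toℕ (h j)) (λ j → toℕ (residue (ℓ j))) ⟩
    ∑[ j < k ] (r * toℕ (h j)) + ∑[ j < k ] toℕ (residue (ℓ j))
      ≡⟨ cong (_+ _) (*-distribˡ-sum r (λ j → toℕ (h j))) ⟨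
    r * ∑[ j < k ] toℕ (h j) + ∑[ j < k ] toℕ (residue (ℓ j)) ∎
    where open ≡-Reasoning

  combine-opposite : ∀ m (h h′ : Fin 2) {σ σ′} → σ′ ≡ σ +ℤ 1F →
    toℕ (combine h (residue (pair m σ))) + toℕ (combine h′ (residue (pair m σ′))) ≡
    r * (toℕ h + toℕ h′ + 1)
  combine-opposite m h h′ {σ} refl = begin
    toℕ (combine h (residue (pair m σ))) + toℕ (combine h′ (residue (pair m (σ +ℤ 1F))))
      ≡⟨ cong₂ _+_ (toℕ-combine h (residue (pair m σ)))
                   (toℕ-combine h′ (residue (pair m (σ +ℤ 1F)))) ⟩
    (r * toℕ h + x) + (r * toℕ h′ + x′)
      ≡⟨ interchange (r * toℕ h) x (r * toℕ h′) x′ ⟩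
    (r * toℕ h + r * toℕ h′) + (x + x′)
      ≡⟨ cong (r * toℕ h + r * toℕ h′ +_) (residues-complementary m σ) ⟩
    (r * toℕ h + r * toℕ h′) + r
      ≡⟨ factor r (toℕ h) (toℕ h′) ⟩
    r * (toℕ h + toℕ h′ + 1) ∎
    where
    open ≡-Reasoning
    x  = toℕ (residue (pair m σ))
    x′ = toℕ (residue (pair m (σ +ℤ 1F)))
    interchange : ∀ a b c d → (a + b) + (c + d) ≡ (a + c) + (b + d)
    interchange = solve-∀
    factor : ∀ r a b → (r * a + r * b) + r ≡ r * (a + b + 1)
    factor = solve-∀

  encode : Fin 2 × Level n × E → Γ r
  encode (h , ℓ , e) = combine h (residue ℓ) , e

  decode : Γ r → Fin 2 × Level n × E
  decode (a , e) = proj₁ (remQuot {2} r a) , residueLevel (proj₂ (remQuot {2} r a)) , e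

  encode↔ : (Fin 2 × Level n × E) ↔ Γ r
  encode↔ = mk↔ₛ′ encode decode encode-decode decode-encode
    where
    encode-decode : ∀ x → encode (decode x) ≡ x
    encode-decode (a , e) = cong (_, e) (begin
      combine h (residue (residueLevel z)) ≡⟨ cong (combine h) (residue-residueLevel z) ⟩
      combine h z                          ≡⟨ combine-remQuot {2} r a ⟩
      a                                    ∎)
      where
      open ≡-Reasoning
      h = proj₁ (remQuot {2} r a)
      z = proj₂ (remQuot {2} r a)
    decode-encode : ∀ x → decode (encode x) ≡ x
    decode-encode (h , ℓ , e) =
      trans (cong (λ (h′ , z) → h′ , residueLevel z , e) (remQuot-combine h (residue ℓ)))
            (cong (λ ℓ′ → h , ℓ′ , e) (residueLevel-residue ℓ))

Label : Set
Label = Fin 2 × E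

-- In row pair m κ the label u becomes the entry height κ u · r + residue (pair m (sign κ u)), so
-- the two rows of a pair give each label opposite signs.
module Signs (signBit : Label → Fin 2) where

  sign : Fin 2 → Label → Fin 2
  sign κ u = signBit u +ℤ κ

  height : Fin 2 → Label → Fin 2
  height κ u = proj₁ u +ℤ sign κ u

  sign-flip : ∀ u → sign 1F u ≡ sign 0F u +ℤ 1F
  sign-flip u with signBit u
  ... | 0F = refl
  ... | 1F = refl

  heights-opposite : ∀ u → toℕ (height 0F u) + toℕ (height 1F u) ≡ 1
  heights-opposite (ε , e) with signBit (ε , e)
  heights-opposite (0F , e) | 0F = refl
  heights-opposite (0F , e) | 1F = refl
  heights-opposite (1F , e) | 0F = refl
  heights-opposite (1F , e) | 1F = refl

  module _ (n : ℕ) where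

    twist : Level n × Label → Fin 2 × Level n × E
    twist (base     , ε , e) = ε , base , e
    twist (pair m κ , u)     = height κ u , pair m (sign κ u) , proj₂ u

    untwist : Fin 2 × Level n × E → Level n × Label
    untwist (h , base     , e) = base , h , e
    untwist (h , pair m σ , e) = pair m (signBit (h +ℤ σ , e) +ℤ σ) , h +ℤ σ , e

    twist↔ : (Level n × Label) ↔ (Fin 2 × Level n × E)
    twist↔ = mk↔ₛ′ twist untwist twist-untwist untwist-twist
      where
      twist-untwist : ∀ x → twist (untwist x) ≡ x
      twist-untwist (h , base     , e) = refl
      twist-untwist (h , pair m σ , e)
        rewrite +ℤ₂-cancelˡ (signBit (h +ℤ σ , e)) σ | +ℤ₂-cancelʳ h σ = refl
      untwist-twist : ∀ x → untwist (twist x) ≡ x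
      untwist-twist (base     , u)     = refl
      untwist-twist (pair m κ , ε , e)
        rewrite +ℤ₂-cancelʳ ε (sign κ (ε , e)) | +ℤ₂-cancelˡ (signBit (ε , e)) κ = refl

Cell : Set
Cell = Fin 2 × Fin 8

Exhaustive : Set → Set₁
Exhaustive A = ∀ {P : A → Set} → (∀ x → Dec (P x)) → Dec (∀ x → P x)

exhaustive-× : ∀ {A B : Set} → Exhaustive A → Exhaustive B → Exhaustive (A × B)
exhaustive-× all-A? all-B? P? =
  map′ (λ p (a , b) → p a b) (λ p a b → p (a , b)) (all-A? λ a → all-B? λ b → P? (a , b))

all-cells? : Exhaustive Cell
all-cells? = exhaustive-× all? all?

all-labels? : Exhaustive Label
all-labels? = exhaustive-× all? (exhaustive-× all? (exhaustive-× all? all?))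

_≟ᶜ_ : DecidableEquality Cell
_≟ᶜ_ = ≡-dec _≟_ _≟_

_≟ˡ_ : DecidableEquality Label
_≟ˡ_ = ≡-dec _≟_ (≡-dec _≟_ (≡-dec _≟_ _≟_))

-- The inverse of a table is found by exhaustive search; table↔ accepts a table only if the
-- search provably inverts it, which is decided by computation.
preimage : (Cell → Label) → Label → Cell
preimage T u with any? (λ t → any? (λ j → T (t , j) ≟ˡ u))
... | yes (t , j , _) = t , j
... | no _            = 0F , 0F

table↔ : (T : Cell → Label) →
         {True (all-labels? λ u → T (preimage T u) ≟ˡ u)} →
         {True (all-cells? λ c → preimage T (T c) ≟ᶜ c)} →
         Cell ↔ Label
table↔ T {onto} {one-one} = mk↔ₛ′ T (preimage T) (toWitness onto) (toWitness one-one)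

baseTable : Cell → Label
baseTable (0F , 0F) = 1F , 0F , 0F , 0F
baseTable (0F , 1F) = 0F , 1F , 1F , 0F
baseTable (0F , 2F) = 0F , 1F , 0F , 0F
baseTable (0F , 3F) = 1F , 0F , 1F , 0F
baseTable (0F , 4F) = 0F , 0F , 1F , 1F
baseTable (0F , 5F) = 1F , 1F , 0F , 0F
baseTable (0F , 6F) = 1F , 1F , 1F , 0F
baseTable (0F , 7F) = 0F , 0F , 0F , 1F
baseTable (1F , 0F) = 0F , 0F , 1F , 0F
baseTable (1F , 1F) = 1F , 1F , 0F , 1F
baseTable (1F , 2F) = 1F , 1F , 1F , 1F
baseTable (1F , 3F) = 0F , 0F , 0F , 0F
baseTable (1F , 4F) = 1F , 0F , 1F , 1F
baseTable (1F , 5F) = 0F , 1F , 0F , 1F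
baseTable (1F , 6F) = 0F , 1F , 1F , 1F
baseTable (1F , 7F) = 1F , 0F , 0F , 1F

specialTable : Cell → Label
specialTable (0F , 0F) = 1F , 0F , 0F , 0F
specialTable (0F , 1F) = 0F , 0F , 1F , 0F
specialTable (0F , 2F) = 0F , 1F , 1F , 0F
specialTable (0F , 3F) = 1F , 1F , 0F , 1F
specialTable (0F , 4F) = 1F , 0F , 1F , 1F
specialTable (0F , 5F) = 0F , 0F , 0F , 1F
specialTable (0F , 6F) = 0F , 1F , 0F , 1F
specialTable (0F , 7F) = 1F , 1F , 1F , 0F
specialTable (1F , 0F) = 0F , 1F , 0F , 0F
specialTable (1F , 1F) = 1F , 1F , 0F , 0F
specialTable (1F , 2F) = 1F , 0F , 1F , 0F
specialTable (1F , 3F) = 0F , 0F , 1F , 1F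
specialTable (1F , 4F) = 0F , 1F , 1F , 1F
specialTable (1F , 5F) = 1F , 1F , 1F , 1F
specialTable (1F , 6F) = 1F , 0F , 0F , 1F
specialTable (1F , 7F) = 0F , 0F , 0F , 0F

genericTable : Cell → Label
genericTable (0F , 0F) = 0F , 0F , 0F , 0F
genericTable (0F , 1F) = 0F , 1F , 0F , 0F
genericTable (0F , 2F) = 0F , 0F , 1F , 0F
genericTable (0F , 3F) = 0F , 1F , 1F , 1F
genericTable (0F , 4F) = 1F , 0F , 0F , 0F
genericTable (0F , 5F) = 1F , 1F , 0F , 1F
genericTable (0F , 6F) = 1F , 0F , 1F , 1F
genericTable (0F , 7F) = 1F , 1F , 1F , 1F
genericTable (1F , 0F) = 0F , 1F , 1F , 0F
genericTable (1F , 1F) = 0F , 0F , 0F , 1F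
genericTable (1F , 2F) = 0F , 1F , 0F , 1F
genericTable (1F , 3F) = 0F , 0F , 1F , 1F
genericTable (1F , 4F) = 1F , 1F , 0F , 0F
genericTable (1F , 5F) = 1F , 0F , 1F , 0F
genericTable (1F , 6F) = 1F , 1F , 1F , 0F
genericTable (1F , 7F) = 1F , 0F , 0F , 1F

signBit : Label → Fin 2
signBit (0F , 0F , 0F , 0F) = 0F
signBit (0F , 1F , 0F , 1F) = 0F
signBit (0F , _)            = 1F
signBit (1F , 1F , 0F , _)  = 1F
signBit (1F , _)            = 0F

baseTable↔ specialTable↔ genericTable↔ : Cell ↔ Label
baseTable↔    = table↔ baseTable
specialTable↔ = table↔ specialTable
genericTable↔ = table↔ genericTable

open Signs signBit

-- The tables are chosen so that the rows of every table sum to 0 in ℤ₂⁴, every row of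
-- specialTable and genericTable has four labels of each sign, and cellwise
-- baseTable + specialTable + genericTable = 0 and signBit ∘ specialTable = signBit ∘ genericTable;
-- the facts below are these conditions in the form in which the sums use them.
record SignedTable (T : Cell → Label) : Set where
  field
    signs-balanced : ∀ κ t → ∑[ j < 8 ] toℕ (sign κ (T (t , j)) +ℤ 1F) ≡ 4
                           × ∑[ j < 8 ] toℕ (sign κ (T (t , j))) ≡ 4
    heights-even   : ∀ κ t → 2 ∣ ∑[ j < 8 ] toℕ (height κ (T (t , j)))

signed? : ∀ T → Dec (SignedTable T)
signed? T = map′ (λ (p , q) → record { signs-balanced = p ; heights-even = q })
                 (λ s → SignedTable.signs-balanced s , SignedTable.heights-even s)
  ((all? λ κ → all? λ t → (∑[ j < 8 ] toℕ (sign κ (T (t , j)) +ℤ 1F) ℕ.≟ 4)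
                           ×-dec (∑[ j < 8 ] toℕ (sign κ (T (t , j))) ℕ.≟ 4))
   ×-dec (all? λ κ → all? λ t → 2 ∣? ∑[ j < 8 ] toℕ (height κ (T (t , j)))))

EvenRows : (Cell → Label) → Set
EvenRows T = ∀ k t → 2 ∣ ∑[ j < 8 ] toℕ (coordinate k (proj₂ (T (t , j))))

evenRows? : ∀ T → Dec (EvenRows T)
evenRows? T = all? λ k → all? λ t → 2 ∣? ∑[ j < 8 ] toℕ (coordinate k (proj₂ (T (t , j))))

specialTable-signed : SignedTable specialTable
specialTable-signed = from-yes (signed? specialTable)

genericTable-signed : SignedTable genericTable
genericTable-signed = from-yes (signed? genericTable)

baseTable-rows-even : EvenRows baseTable
baseTable-rows-even = from-yes (evenRows? baseTable)

specialTable-rows-even : EvenRows specialTable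
specialTable-rows-even = from-yes (evenRows? specialTable)

genericTable-rows-even : EvenRows genericTable
genericTable-rows-even = from-yes (evenRows? genericTable)

baseTable-ε-even : ∀ t → 2 ∣ ∑[ j < 8 ] toℕ (proj₁ (baseTable (t , j)))
baseTable-ε-even = from-yes (all? λ t → 2 ∣? ∑[ j < 8 ] toℕ (proj₁ (baseTable (t , j))))

level₀-signs-opposite : ∀ c → sign 1F (genericTable c) ≡ sign 0F (specialTable c) +ℤ 1F
level₀-signs-opposite =
  from-yes (all-cells? λ c → sign 1F (genericTable c) ≟ sign 0F (specialTable c) +ℤ 1F)

level₀-heights-even : ∀ c →
  2 ∣ toℕ (proj₁ (baseTable c)) +
      (toℕ (height 0F (specialTable c)) + toℕ (height 1F (genericTable c)) + 1)
level₀-heights-even = from-yes (all-cells? λ c →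
  2 ∣? toℕ (proj₁ (baseTable c)) +
       (toℕ (height 0F (specialTable c)) + toℕ (height 1F (genericTable c)) + 1))

level₀-coordinates-even : ∀ k c →
  2 ∣ toℕ (coordinate k (proj₂ (baseTable c))) +
      (toℕ (coordinate k (proj₂ (specialTable c))) + toℕ (coordinate k (proj₂ (genericTable c))))
level₀-coordinates-even = from-yes (all? λ k → all-cells? λ c →
  2 ∣? toℕ (coordinate k (proj₂ (baseTable c))) +
       (toℕ (coordinate k (proj₂ (specialTable c))) + toℕ (coordinate k (proj₂ (genericTable c)))))

module Construction (n′ : ℕ) where

  n : ℕ
  n = suc n′

  open Levels n

  tableAt↔ : Level n → Cell ↔ Label
  tableAt↔ base         = baseTable↔
  tableAt↔ (pair 0F 0F) = specialTable↔
  tableAt↔ (pair _ _)   = genericTable↔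

  tableAt : Level n → Cell → Label
  tableAt ℓ = Inverse.to (tableAt↔ ℓ)

  cells↔ : (Fin 2 × Fin r × Fin 8) ↔ (Level n × Label)
  cells↔ = mk↔ₛ′ to from to-from from-to
    where
    to : Fin 2 × Fin r × Fin 8 → Level n × Label
    to (t , i , j) = toLevel i , tableAt (toLevel i) (t , j)
    from : Level n × Label → Fin 2 × Fin r × Fin 8
    from (ℓ , u) = let (t , j) = Inverse.from (tableAt↔ ℓ) u in t , fromLevel ℓ , j
    to-from : ∀ x → to (from x) ≡ x
    to-from (ℓ , u)
      rewrite toLevel-fromLevel ℓ = cong (ℓ ,_) (Inverse.strictlyInverseˡ (tableAt↔ ℓ) u)
    from-to : ∀ x → from (to x) ≡ x
    from-to (t , i , j)
      rewrite Inverse.strictlyInverseʳ (tableAt↔ (toLevel i)) (t , j) | fromLevel-toLevel i = refl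

  entries↔ : (Fin 2 × Fin r × Fin 8) ↔ Γ r
  entries↔ = ↔-trans cells↔ (↔-trans (twist↔ n) encode↔)

  entry : Level n → Label → Γ r
  entry ℓ u = encode (twist n (ℓ , u))

  base-row : ∀ t → ΣΓ {n + n} 8 (λ j → entry base (baseTable (t , j))) ≡ 0Γ (n + n)
  base-row t =
    ΣΓ≡0Γ {n + n} (λ j → entry base (baseTable (t , j))) ℤ-part (λ k → baseTable-rows-even k t)
    where
    ε : Fin 8 → Fin 2
    ε j = proj₁ (baseTable (t , j))
    ℤ-part : 2 * r ∣ ∑[ j < 8 ] toℕ (combine (ε j) (residue base))
    ℤ-part = begin
      2 * r                                         ∣⟨ 2r∣r*even (baseTable-ε-even t) ⟩
      r * ∑[ j < 8 ] toℕ (ε j)                      ≡⟨ +-identityʳ _ ⟨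
      r * ∑[ j < 8 ] toℕ (ε j) + 0                  ≡⟨ ∑-combine ε (λ _ → base) ⟨
      ∑[ j < 8 ] toℕ (combine (ε j) (residue base)) ∎
      where open ∣-Reasoning

  pair-row : ∀ {T} → SignedTable T → EvenRows T → ∀ m κ t →
             ΣΓ {n + n} 8 (λ j → entry (pair m κ) (T (t , j))) ≡ 0Γ (n + n)
  pair-row {T} signed rows-even m κ t =
    ΣΓ≡0Γ {n + n} (λ j → entry (pair m κ) (T (t , j))) ℤ-part (λ k → rows-even k t)
    where
    open SignedTable signed
    σ h : Fin 8 → Fin 2
    σ j = sign κ (T (t , j))
    h j = height κ (T (t , j))
    x : Fin 2 → ℕ
    x s = toℕ (residue (pair m s))
    H : ℕ
    H = ∑[ j < 8 ] toℕ (h j)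
    residues : ∑[ j < 8 ] x (σ j) ≡ 4 * r
    residues = begin
      ∑[ j < 8 ] x (σ j)
        ≡⟨ ∑-two-valued σ x ⟩
      ∑[ j < 8 ] toℕ (σ j +ℤ 1F) * x 0F + ∑[ j < 8 ] toℕ (σ j) * x 1F
        ≡⟨ cong₂ (λ a b → a * x 0F + b * x 1F)
                 (proj₁ (signs-balanced κ t)) (proj₂ (signs-balanced κ t)) ⟩
      4 * x 0F + 4 * x 1F
        ≡⟨ *-distribˡ-+ 4 (x 0F) (x 1F) ⟨
      4 * (x 0F + x 1F)
        ≡⟨ cong (4 *_) (residues-complementary m 0F) ⟩
      4 * r ∎
      where open ≡-Reasoning
    ℤ-part : 2 * r ∣ ∑[ j < 8 ] toℕ (combine (h j) (residue (pair m (σ j))))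
    ℤ-part = begin
      2 * r                       ∣⟨ 2r∣r*even (∣m∣n⇒∣m+n (heights-even κ t) (divides 2 refl)) ⟩
      r * (H + 4)                 ≡⟨ *-distribˡ-+ r H 4 ⟩
      r * H + r * 4               ≡⟨ cong (r * H +_) (trans (*-comm r 4) (sym residues)) ⟩
      r * H + ∑[ j < 8 ] x (σ j)  ≡⟨ ∑-combine h (λ j → pair m (σ j)) ⟨
      ∑[ j < 8 ] toℕ (combine (h j) (residue (pair m (σ j)))) ∎
      where open ∣-Reasoning

  row-zero : ∀ t ℓ → ΣΓ {n + n} 8 (λ j → entry ℓ (tableAt ℓ (t , j))) ≡ 0Γ (n + n)
  row-zero t base              = base-row t
  row-zero t (pair 0F 0F)      = pair-row specialTable-signed specialTable-rows-even 0F 0F t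
  row-zero t (pair 0F 1F)      = pair-row genericTable-signed genericTable-rows-even 0F 1F t
  row-zero t (pair (fsuc m) κ) = pair-row genericTable-signed genericTable-rows-even (fsuc m) κ t

  column-∣ : ∀ {d} (g : Level n → ℕ) →
    d ∣ g base + (g (pair 0F 0F) + g (pair 0F 1F)) →
    (∀ m → d ∣ g (pair (fsuc m) 0F) + g (pair (fsuc m) 1F)) →
    d ∣ ∑[ i < r ] g (toLevel i)
  column-∣ {d} g level₀ generic = begin
    d                                                   ∣⟨ ∣m∣n⇒∣m+n level₀ (∑-∣ _ generic) ⟩
    (g base + (g (pair 0F 0F) + g (pair 0F 1F))) + rest ≡⟨ +-assoc (g base) _ rest ⟩
    g base + ∑[ m < n ] (g (pair m 0F) + g (pair m 1F)) ≡⟨ ∑-levels g ⟨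
    ∑[ i < r ] g (toLevel i)                            ∎
    where
    open ∣-Reasoning
    rest = ∑[ m < n′ ] (g (pair (fsuc m) 0F) + g (pair (fsuc m) 1F))

  value : Cell → Level n → ℕ
  value c ℓ = toℕ (proj₁ (entry ℓ (tableAt ℓ c)))

  level₀-column : ∀ c → 2 * r ∣ value c base + (value c (pair 0F 0F) + value c (pair 0F 1F))
  level₀-column c = begin
    2 * r                                   ∣⟨ 2r∣r*even (level₀-heights-even c) ⟩
    r * (toℕ ε₀ + (toℕ hₛ + toℕ hᵧ + 1))    ≡⟨ *-distribˡ-+ r (toℕ ε₀) _ ⟩
    r * toℕ ε₀ + r * (toℕ hₛ + toℕ hᵧ + 1)
      ≡⟨ cong₂ _+_ (trans (toℕ-combine ε₀ 0F) (+-identityʳ _))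
                   (combine-opposite 0F hₛ hᵧ (level₀-signs-opposite c)) ⟨
    value c base + (value c (pair 0F 0F) + value c (pair 0F 1F)) ∎
    where
    open ∣-Reasoning
    ε₀ hₛ hᵧ : Fin 2
    ε₀ = proj₁ (baseTable c)
    hₛ = height 0F (specialTable c)
    hᵧ = height 1F (genericTable c)

  generic-column : ∀ c m → 2 * r ∣ value c (pair (fsuc m) 0F) + value c (pair (fsuc m) 1F)
  generic-column c m = begin
    2 * r
      ∣⟨ 2r∣r*even (subst (λ a → 2 ∣ a + 1) (sym (heights-opposite u)) (divides 1 refl)) ⟩
    r * (toℕ (height 0F u) + toℕ (height 1F u) + 1)
      ≡⟨ combine-opposite (fsuc m) (height 0F u) (height 1F u) (sign-flip u) ⟨
    value c (pair (fsuc m) 0F) + value c (pair (fsuc m) 1F) ∎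
    where
    open ∣-Reasoning
    u = genericTable c

  column-zero : ∀ c → ΣΓ {n + n} r (λ i → entry (toLevel i) (tableAt (toLevel i) c)) ≡ 0Γ (n + n)
  column-zero c = ΣΓ≡0Γ {n + n} (λ i → entry (toLevel i) (tableAt (toLevel i) c))
    (column-∣ (value c) (level₀-column c) (generic-column c))
    (λ k → column-∣ (coordinateAt k) (level₀-coordinates-even k c)
                    (λ _ → 2∣n+n (toℕ (coordinate k (proj₂ (genericTable c))))))
    where
    coordinateAt : Fin 3 → Level n → ℕ
    coordinateAt k ℓ = toℕ (coordinate k (proj₂ (entry ℓ (tableAt ℓ c))))

  mrs : ZeroSumMRS (n + n) r 8 2
  mrs = record
    { A         = λ t i j → Inverse.to entries↔ (t , i , j)
    ; bijective = Bijection.bijective (Inverse⇒Bijection entries↔)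
    ; rowSum    = λ t i → row-zero t (toLevel i)
    ; colSum    = λ t j → column-zero (t , j)
    }

odd-suc⇒double : ∀ k → suc k % 2 ≡ 1 → ∃ λ m → k ≡ m + m
odd-suc⇒double zero          _   = 0 , refl
odd-suc⇒double (suc zero)    ()
odd-suc⇒double (suc (suc k)) odd with odd-suc⇒double k odd
... | m , refl = suc m , cong suc (sym (+-suc m m))

lemma4p10 : (k : ℕ) → 3 ≤ suc k → suc k % 2 ≡ 1 → ZeroSumMRS k (suc k) 8 2
lemma4p10 k 3≤r odd with odd-suc⇒double k odd
... | zero   , refl = contradiction 3≤r λ { (s≤s ()) }
... | suc n′ , refl = Construction.mrs n′
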